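{- Let $\vec H$ be an acyclic orientation of an undirected graph $H$. Let $k\geq 3$, and suppose there are pairwise distinct vertices $u_0,\dots,u_{k-1},x_0,\dots,x_{k-1}\in V(\vec H)$ such that for every $0\leq i\leq k-1$, $x_i\in R(u_{i-1})\cap R(u_i)$ and $x_i\notin R(u_j)$ for all $j\neq i,i-1$ (indices modulo $k$). Then $H$ contains an induced copy of the cycle $C_\ell$ for some $\ell\geq 6$.
   Context: For a vertex $u$ of a directed graph, $R(u)$ is the set of vertices $v$ such that there is a directed path from $u$ to $v$ (so $u\in R(u)$). -}

module Defs where

open import Data.Nat using (ℕ; suc)
open import Data.Bool using (Bool; T)
open import Data.Fin using (Fin; zero; suc; fromℕ; inject₁)
open import Data.Product using (_×_; Σ)
open import Data.Sum using (_⊎_)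
open import Relation.Nullary using (¬_)
open import Relation.Binary.PropositionalEquality using (_≡_)
open import Relation.Binary.Construct.Closure.Transitive using (TransClosure)
open import Relation.Binary.Construct.Closure.ReflexiveTransitive using (Star)
open import Function.Bundles using (_⇔_)
open import Function.Definitions using (Injective)

cpred : ∀ {k} → Fin k → Fin k
cpred {suc k} zero    = fromℕ k
cpred {suc k} (suc i) = inject₁ i

record Graph (n : ℕ) : Set where
  field
    adj   : Fin n → Fin n → Bool
    sym   : ∀ a b → adj a b ≡ adj b a
    irref : ∀ a → ¬ T (adj a a)

open Graph public

IsOrientation : ∀ {n} → Graph n → (Fin n → Fin n → Bool) → Set
IsOrientation H D =
  (∀ a b → T (adj H a b) ⇔ (T (D a b) ⊎ T (D b a))) ×
  (∀ a b → ¬ (T (D a b) × T (D b a)))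

Arc : ∀ {n} → (Fin n → Fin n → Bool) → Fin n → Fin n → Set
Arc D a b = T (D a b)

Acyclic : ∀ {n} → (Fin n → Fin n → Bool) → Set
Acyclic D = ∀ a → ¬ TransClosure (Arc D) a a

-- v ∈ R(u): there is a directed path (possibly of length 0) from u to v.
Reach : ∀ {n} → (Fin n → Fin n → Bool) → Fin n → Fin n → Set
Reach D u v = Star (Arc D) u v

CycleAdj : ∀ {ℓ} → Fin ℓ → Fin ℓ → Set
CycleAdj i j = (i ≡ cpred j) ⊎ (j ≡ cpred i)

InducedCycle : ∀ {n} → Graph n → ℕ → Set
InducedCycle {n} H ℓ =
  Σ (Fin ℓ → Fin n) λ f →
    Injective _≡_ _≡_ f × (∀ i j → T (adj H (f i) (f j)) ⇔ CycleAdj i j)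

-- Tighten the configuration first: replace each x i by a ⇝-minimal common descendant of
-- u (cpred i) and u i lying above x i, and then each u i by a ⇝-maximal descendant that still
-- reaches x i and x (csucc i); the reachability pattern survives both steps. Now join
-- u (cpred i) to x i and x i to u i by shortest directed paths, forming the i-th piece.
-- Shortest directed paths of an acyclic orientation are induced, minimality of x i keeps the
-- two paths of one piece apart except at x i, and maximality of the u's together with the
-- reachability pattern shows that a vertex of the i-th piece reaches a vertex of another piece
-- only if it is u (cpred i) and the other piece is the previous one. So the k pieces close up
-- into an induced cycle with at least two vertices per piece, of length at least 2k ≥ 6.

module Submission where

open import Defs hiding (sym)
open import Data.Nat as ℕ using (ℕ; zero; suc; _+_; _*_; _≤_; _<_; z≤n; s≤s)
import Data.Nat.Properties as ℕ
open import Data.Nat.DivMod using (_mod_; m<n⇒m%n≡m)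
open import Data.Fin as Fin using (Fin; zero; suc; toℕ)
import Data.Fin.Properties as Fin
open import Data.Bool using (Bool; T; T?)
open import Data.Empty using (⊥; ⊥-elim)
open import Data.Unit using (⊤; tt)
open import Data.Product using (Σ; ∃; ∃₂; _×_; _,_; proj₁; proj₂; map₂)
open import Data.Sum using (_⊎_; inj₁; inj₂; swap)
open import Data.List using (List; []; _∷_; _++_; _∷ʳ_; length; lookup; initLast; _∷ʳ′_)
import Data.List.Properties as List
open import Data.List.Membership.Propositional using (_∈_)
open import Data.List.Membership.Propositional.Properties using (∈-++⁻; ∈-++⁺ˡ; ∈-++⁺ʳ)
open import Data.List.Relation.Unary.Any using (here; there)
open import Data.List.Relation.Unary.All as All using (All; []; _∷_)
import Data.List.Relation.Unary.All.Properties as All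
open import Function using (flip; id; _∘_)
open import Function.Bundles using (_⇔_; mk⇔; Equivalence)
open import Function.Definitions using (Injective)
open import Relation.Nullary using (¬_; Dec; yes; no; ¬?)
open import Relation.Nullary.Decidable using (_×-dec_; decidable-stable)
open import Relation.Binary.PropositionalEquality
  using (_≡_; _≢_; refl; sym; trans; cong; subst; subst₂; module ≡-Reasoning)
open import Relation.Binary.Construct.Closure.Transitive using (TransClosure; [_]; _∷_)
open import Relation.Binary.Construct.Closure.ReflexiveTransitive using (Star; ε; _◅_; _◅◅_; reverse)

-- Cyclic indices

CSucc : ℕ → ℕ → ℕ → Set
CSucc m a b = b ≡ suc a ⊎ (a ≡ m × b ≡ 0)

CSucc-irrefl : ∀ {m a} → ¬ CSucc (suc m) a a
CSucc-irrefl {a = a} (inj₁ a≡1+a) = ℕ.m≢1+n+m a {0} a≡1+a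
CSucc-irrefl (inj₂ (refl , ()))

CSucc-asym : ∀ {m a b} → CSucc (suc (suc m)) a b → ¬ CSucc (suc (suc m)) b a
CSucc-asym {a = a} (inj₁ refl) (inj₁ a≡2+a) = ℕ.m≢1+n+m a {1} a≡2+a
CSucc-asym (inj₁ refl) (inj₂ (() , refl))
CSucc-asym (inj₂ (refl , refl)) (inj₁ ())
CSucc-asym (inj₂ (refl , refl)) (inj₂ (() , _))

≡cpred⇒CSucc : ∀ {m} {i j : Fin (suc m)} → i ≡ cpred j → CSucc m (toℕ i) (toℕ j)
≡cpred⇒CSucc {m} {j = zero}  refl = inj₂ (Fin.toℕ-fromℕ m , refl)
≡cpred⇒CSucc     {j = suc j} refl = inj₁ (cong suc (sym (Fin.toℕ-inject₁ j)))

CSucc⇒≡cpred : ∀ {m} {i j : Fin (suc m)} → CSucc m (toℕ i) (toℕ j) → i ≡ cpred j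
CSucc⇒≡cpred {m} {j = zero} (inj₂ (i≡m , _)) =
  Fin.toℕ-injective (trans i≡m (sym (Fin.toℕ-fromℕ m)))
CSucc⇒≡cpred {j = suc j} (inj₁ e) =
  Fin.toℕ-injective (trans (ℕ.suc-injective (sym e)) (sym (Fin.toℕ-inject₁ j)))
CSucc⇒≡cpred {j = zero}  (inj₁ ())
CSucc⇒≡cpred {j = suc j} (inj₂ (_ , ()))

cpred-injective : ∀ {m} {i j : Fin (suc m)} → cpred i ≡ cpred j → i ≡ j
cpred-injective {i = zero}  {zero}  _ = refl
cpred-injective {i = zero}  {suc j} e = ⊥-elim (Fin.fromℕ≢inject₁ e)
cpred-injective {i = suc i} {zero}  e = ⊥-elim (Fin.fromℕ≢inject₁ (sym e))
cpred-injective {i = suc i} {suc j} e = cong suc (Fin.inject₁-injective e)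

csucc : ∀ {m} → Fin (suc m) → Fin (suc m)
csucc {m} i with m ℕ.≟ toℕ i
... | yes _   = zero
... | no m≢i = suc (Fin.lower₁ i m≢i)

cpred-csucc : ∀ {m} (i : Fin (suc m)) → cpred (csucc i) ≡ i
cpred-csucc {m} i with m ℕ.≟ toℕ i
... | yes m≡i = Fin.toℕ-injective (trans (Fin.toℕ-fromℕ m) m≡i)
... | no m≢i = Fin.inject₁-lower₁ i m≢i

csucc-cpred : ∀ {m} (i : Fin (suc m)) → csucc (cpred i) ≡ i
csucc-cpred i = cpred-injective (cpred-csucc (cpred i))

cpred≢ : ∀ {m} (i : Fin (suc (suc m))) → cpred i ≢ i
cpred≢ i e = CSucc-irrefl (≡cpred⇒CSucc (sym e))

cpred²≢ : ∀ {m} (i : Fin (suc (suc (suc m)))) → cpred (cpred i) ≢ i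
cpred²≢ i e = CSucc-asym (≡cpred⇒CSucc {i = cpred i} refl) (≡cpred⇒CSucc (sym e))

-- Walks

⁺⇒⋆ : ∀ {A : Set} {R : A → A → Set} {a b} → TransClosure R a b → Star R a b
⁺⇒⋆ [ r ]   = r ◅ ε
⁺⇒⋆ (r ∷ p) = r ◅ ⁺⇒⋆ p

module Walks {n : ℕ} (D : Fin n → Fin n → Bool) where

  infix 4 _⟶_ _⇝_ _⟶⁺_

  _⟶_ _⇝_ _⟶⁺_ : Fin n → Fin n → Set
  _⟶_  = Arc D
  _⇝_  = Reach D
  _⟶⁺_ = TransClosure _⟶_

  ◅-⁺ : ∀ {a b c} → a ⟶ b → b ⇝ c → a ⟶⁺ c
  ◅-⁺ r ε       = [ r ]
  ◅-⁺ r (s ◅ p) = r ∷ ◅-⁺ s p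

  targets : ∀ {a b} → a ⇝ b → List (Fin n)
  targets ε                 = []
  targets (_◅_ {j = c} _ p) = c ∷ targets p

  vertices : ∀ {a b} → a ⇝ b → List (Fin n)
  vertices {a} p = a ∷ targets p

  sources : ∀ {a b} → a ⇝ b → List (Fin n)
  sources ε             = []
  sources {a} (_ ◅ p)   = a ∷ sources p

  inner : ∀ {a b} → a ⇝ b → List (Fin n)
  inner ε       = []
  inner (_ ◅ p) = sources p

  steps : ∀ {a b} → a ⇝ b → ℕ
  steps p = length (targets p)

  steps-◅◅ : ∀ {a b c} (p : a ⇝ b) (q : b ⇝ c) → steps (p ◅◅ q) ≡ steps p + steps q
  steps-◅◅ ε       q = refl
  steps-◅◅ (_ ◅ p) q = cong suc (steps-◅◅ p q)

  vertices≡sources∷ʳ : ∀ {a b} (p : a ⇝ b) → vertices p ≡ sources p ∷ʳ b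
  vertices≡sources∷ʳ ε           = refl
  vertices≡sources∷ʳ {a} (_ ◅ p) = cong (a ∷_) (vertices≡sources∷ʳ p)

  sources≡∷inner : ∀ {a b} (p : a ⇝ b) → a ≢ b → sources p ≡ a ∷ inner p
  sources≡∷inner ε       a≢a = ⊥-elim (a≢a refl)
  sources≡∷inner (_ ◅ _) _   = refl

  steps>0 : ∀ {a b} (p : a ⇝ b) → a ≢ b → 0 < steps p
  steps>0 ε       a≢a = ⊥-elim (a≢a refl)
  steps>0 (_ ◅ _) _   = s≤s z≤n

  ⇝∈vertices : ∀ {a b} (p : a ⇝ b) {y} → y ∈ vertices p → a ⇝ y
  ⇝∈vertices p       (here refl) = ε
  ⇝∈vertices (r ◅ p) (there y∈p) = r ◅ ⇝∈vertices p y∈p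

  ∈vertices⇝ : ∀ {a b} (p : a ⇝ b) {y} → y ∈ vertices p → Σ (y ⇝ b) λ q → steps q ≤ steps p
  ∈vertices⇝ p       (here refl) = p , ℕ.≤-refl
  ∈vertices⇝ (_ ◅ p) (there y∈p) = map₂ ℕ.m≤n⇒m≤1+n (∈vertices⇝ p y∈p)

  ∈sources⇒∈vertices : ∀ {a b} (p : a ⇝ b) {y} → y ∈ sources p → y ∈ vertices p
  ∈sources⇒∈vertices (_ ◅ _) (here refl) = here refl
  ∈sources⇒∈vertices (_ ◅ p) (there y∈p) = there (∈sources⇒∈vertices p y∈p)

  prefix : ∀ {a b} (p : a ⇝ b) (i : Fin (length (vertices p))) → a ⇝ lookup (vertices p) i
  prefix p       zero    = ε
  prefix (r ◅ p) (suc i) = r ◅ prefix p i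

  lookup-⁺ : ∀ {a b} (p : a ⇝ b) {i j} → i Fin.< j → lookup (vertices p) i ⟶⁺ lookup (vertices p) j
  lookup-⁺ (r ◅ p) {zero}  {suc j} _         = ◅-⁺ r (prefix p j)
  lookup-⁺ (_ ◅ p) {suc i} {suc j} (s≤s i<j) = lookup-⁺ p i<j

  ReachWithin : ℕ → Fin n → Fin n → Set
  ReachWithin m a b = Σ (a ⇝ b) λ p → steps p ≤ m

  reachWithin? : ∀ m a b → Dec (ReachWithin m a b)
  reachWithin? m a b with a Fin.≟ b
  ... | yes refl = yes (ε , z≤n)
  reachWithin? zero    a b | no a≢b = no λ { (ε , _) → a≢b refl ; (_ ◅ _ , ()) }
  reachWithin? (suc m) a b | no a≢b with Fin.any? (λ c → T? (D a c) ×-dec reachWithin? m c b)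
  ... | yes (_ , r , p , p≤m) = yes (r ◅ p , s≤s p≤m)
  ... | no ∄c = no λ { (ε , _) → a≢b refl ; (r ◅ p , s≤s p≤m) → ∄c (_ , r , p , p≤m) }

  shortest-walk : ∀ {a b} → a ⇝ b → Σ (a ⇝ b) λ p → ∀ (q : a ⇝ b) → steps p ≤ steps q
  shortest-walk p₀ = go (steps p₀) (p₀ , ℕ.≤-refl)
    where
    go : ∀ m {a b} → ReachWithin m a b → Σ (a ⇝ b) λ p → ∀ (q : a ⇝ b) → steps p ≤ steps q
    go zero    (p , p≤0)   = p , λ _ → ℕ.≤-trans p≤0 z≤n
    go (suc m) (p , p≤1+m) with reachWithin? m _ _
    ... | yes shorter = go m shorter
    ... | no ∄shorter = p , λ q → ℕ.≤-trans p≤1+m (ℕ.≰⇒> λ q≤m → ∄shorter (q , q≤m))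

module AcyclicWalks {n : ℕ} {D : Fin n → Fin n → Bool} (acyclic : Acyclic D) where
  open Walks D

  no-return : ∀ {a b} → a ⟶ b → b ⇝ a → ⊥
  no-return r p = acyclic _ (◅-⁺ r p)

  steps<n : ∀ {a b} (p : a ⇝ b) → steps p < n
  steps<n p with steps p ℕ.<? n
  ... | yes p<n = p<n
  ... | no p≮n with Fin.pigeonhole (s≤s (ℕ.≮⇒≥ p≮n)) (lookup (vertices p))
  ...   | _ , _ , i<j , same = ⊥-elim (acyclic _ (subst (_ ⟶⁺_) (sym same) (lookup-⁺ p i<j)))

  _⇝?_ : ∀ a b → Dec (a ⇝ b)
  a ⇝? b with reachWithin? n a b
  ... | yes (p , _) = yes p
  ... | no ∄p = no λ p → ∄p (p , ℕ.<⇒≤ (steps<n p))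

  maximal-reachable : ∀ {P : Fin n → Set} → (∀ v → Dec (P v)) → ∀ {v₀} → P v₀ →
    ∃ λ v → v₀ ⇝ v × P v × (∀ w → v ⇝ w → P w → w ≡ v)
  maximal-reachable {P} P? = go n steps<n
    where
    go : ∀ fuel {v} → (∀ {w} (q : v ⇝ w) → steps q < fuel) → P v →
         ∃ λ v′ → v ⇝ v′ × P v′ × (∀ w → v′ ⇝ w → P w → w ≡ v′)
    go zero    bound _ = ⊥-elim (ℕ.n≮0 (bound ε))
    go (suc fuel) {v} bound Pv with Fin.any? (λ w → (v ⇝? w) ×-dec P? w ×-dec ¬? (w Fin.≟ v))
    ... | no ∄w = v , ε , Pv , λ w v⇝w Pw →
                    decidable-stable (w Fin.≟ v) λ w≢v → ∄w (w , v⇝w , Pw , w≢v)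
    ... | yes (w , v⇝w , Pw , w≢v) =
          let v′ , w⇝v′ , maximal = go fuel bound′ Pw in v′ , v⇝w ◅◅ w⇝v′ , maximal
      where
      bound′ : ∀ {y} (q : w ⇝ y) → steps q < fuel
      bound′ q = ℕ.<-≤-trans (ℕ.m<n+m (steps q) (steps>0 v⇝w (w≢v ∘ sym)))
                   (ℕ.≤-pred (subst (_< suc fuel) (steps-◅◅ v⇝w q) (bound (v⇝w ◅◅ q))))

-- Induced paths and cycles

data At {A : Set} : List A → ℕ → A → Set where
  at-head : ∀ {x xs} → At (x ∷ xs) 0 x
  at-tail : ∀ {x xs i y} → At xs i y → At (x ∷ xs) (suc i) y

At-< : ∀ {A : Set} {xs : List A} {i y} → At xs i y → i < length xs
At-< at-head     = s≤s z≤n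
At-< (at-tail p) = s≤s (At-< p)

At-++⁻ˡ : ∀ {A : Set} (xs : List A) {ys i y} → At (xs ++ ys) i y → i < length xs → At xs i y
At-++⁻ˡ (_ ∷ _)  at-head     _         = at-head
At-++⁻ˡ (_ ∷ xs) (at-tail p) (s≤s i<) = at-tail (At-++⁻ˡ xs p i<)

At-∷ʳ-last : ∀ {A : Set} (xs : List A) {x y} → At (xs ∷ʳ x) (length xs) y → y ≡ x
At-∷ʳ-last []       at-head     = refl
At-∷ʳ-last (_ ∷ xs) (at-tail p) = At-∷ʳ-last xs p

At-lookup : ∀ {A : Set} (xs : List A) (i : Fin (length xs)) → At xs (toℕ i) (lookup xs i)
At-lookup (_ ∷ _)  zero    = at-head
At-lookup (_ ∷ xs) (suc i) = at-tail (At-lookup xs i)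

All-At : ∀ {A : Set} {P : A → Set} {xs i y} → All P xs → At xs i y → P y
All-At (px ∷ _)  at-head     = px
All-At (_ ∷ pxs) (at-tail p) = All-At pxs p

length-∷ʳ : ∀ {A : Set} (xs : List A) {x} → length (xs ∷ʳ x) ≡ suc (length xs)
length-∷ʳ []       = refl
length-∷ʳ (_ ∷ xs) = cong suc (length-∷ʳ xs)

≢[]⇒∷ʳ : ∀ {A : Set} (xs : List A) → xs ≢ [] → ∃₂ λ ys y → xs ≡ ys ∷ʳ y
≢[]⇒∷ʳ xs xs≢[] with initLast xs
... | []      = ⊥-elim (xs≢[] refl)
... | ys ∷ʳ′ y = ys , y , refl

≢[]⇒0<length : ∀ {A : Set} (xs : List A) → xs ≢ [] → 0 < length xs
≢[]⇒0<length []      []≢[] = ⊥-elim ([]≢[] refl)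
≢[]⇒0<length (_ ∷ _) _     = s≤s z≤n

Consecutive : ℕ → ℕ → Set
Consecutive a b = b ≡ suc a ⊎ a ≡ suc b

Consecutive-sym : ∀ {a b} → Consecutive a b → Consecutive b a
Consecutive-sym (inj₁ e) = inj₂ e
Consecutive-sym (inj₂ e) = inj₁ e

CycAdj : ℕ → ℕ → ℕ → Set
CycAdj m a b = CSucc m a b ⊎ CSucc m b a

CycAdj-sym : ∀ {m a b} → CycAdj m a b → CycAdj m b a
CycAdj-sym (inj₁ e) = inj₂ e
CycAdj-sym (inj₂ e) = inj₁ e

module InducedPaths {n : ℕ} (H : Graph n) where

  infix 4 _~_

  _~_ : Fin n → Fin n → Set
  a ~ b = T (adj H a b)

  ~-sym : ∀ {a b} → a ~ b → b ~ a
  ~-sym {a} {b} = subst T (Graph.sym H a b)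

  ~⇒≢ : ∀ {a b} → a ~ b → a ≢ b
  ~⇒≢ {a} a~b refl = irref H a a~b

  Meets : Fin n → Fin n → Set
  Meets a b = a ≡ b ⊎ a ~ b

  Meets-sym : ∀ {a b} → Meets a b → Meets b a
  Meets-sym (inj₁ a≡b) = inj₁ (sym a≡b)
  Meets-sym (inj₂ a~b) = inj₂ (~-sym a~b)

  InducedPath : List (Fin n) → Set
  InducedPath []          = ⊤
  InducedPath (_ ∷ [])    = ⊤
  InducedPath (a ∷ b ∷ r) = a ~ b × All (¬_ ∘ Meets a) r × InducedPath (b ∷ r)

  induced-tail : ∀ {a} r → InducedPath (a ∷ r) → InducedPath r
  induced-tail []      _            = tt
  induced-tail (_ ∷ _) (_ , _ , ip) = ip

  induced-head-fresh : ∀ {a} r → InducedPath (a ∷ r) → All (a ≢_) r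
  induced-head-fresh []      _             = []
  induced-head-fresh (_ ∷ _) (a~b , far , _) = ~⇒≢ a~b ∷ All.map (_∘ inj₁) far

  induced-++⁻ˡ : ∀ X {Y} → InducedPath (X ++ Y) → InducedPath X
  induced-++⁻ˡ []          _                  = tt
  induced-++⁻ˡ (_ ∷ [])    _                  = tt
  induced-++⁻ˡ (_ ∷ b ∷ X) (a~b , far , ip) = a~b , All.++⁻ˡ X far , induced-++⁻ˡ (b ∷ X) ip

  induced-last-fresh : ∀ X {c} → InducedPath (X ∷ʳ c) → All (_≢ c) X
  induced-last-fresh []      _  = []
  induced-last-fresh (_ ∷ X) ip =
    proj₂ (All.∷ʳ⁻ (induced-head-fresh (X ∷ʳ _) ip)) ∷ induced-last-fresh X (induced-tail (X ∷ʳ _) ip)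

  induced-last-adjacent : ∀ X {w c} → InducedPath (X ++ w ∷ c ∷ []) → w ~ c
  induced-last-adjacent []      (w~c , _) = w~c
  induced-last-adjacent (_ ∷ X) ip        = induced-last-adjacent X (induced-tail (X ++ _) ip)

  induced-far : ∀ X {w c} → InducedPath (X ++ w ∷ c ∷ []) → All (λ y → ¬ Meets y c) X
  induced-far []          _               = []
  induced-far (_ ∷ [])    (_ , far , ip)  = All.head far ∷ []
  induced-far (_ ∷ b ∷ X) (_ , far , ip)  =
    All.lookup far (∈-++⁺ʳ X (there (here refl))) ∷ induced-far (b ∷ X) ip

  induced-join : ∀ A {c B} → InducedPath (A ∷ʳ c) → InducedPath (c ∷ B) →
                 (∀ {y w} → y ∈ A → w ∈ B → ¬ Meets y w) → InducedPath (A ++ c ∷ B)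
  induced-join []          _                ipB _   = ipB
  induced-join (_ ∷ [])    (a~c , _ , _)    ipB sep = a~c , All.tabulate (sep (here refl)) , ipB
  induced-join (_ ∷ b ∷ A) (a~b , far , ipA) ipB sep =
    a~b , All.++⁺ (All.++⁻ˡ A far) (All.head (All.++⁻ʳ A far) ∷ All.tabulate (sep (here refl))) ,
    induced-join (b ∷ A) ipA ipB (sep ∘ there)

  record Faithful (R : ℕ → ℕ → Set) (a b : ℕ) (x y : Fin n) : Set where
    constructor faithful
    field
      sound     : x ~ y → R a b
      complete  : R a b → x ~ y
      injective : x ≡ y → a ≡ b

  faithful-swap : ∀ {R : ℕ → ℕ → Set} → (∀ {a b} → R a b → R b a) →
                  ∀ {a b x y} → Faithful R a b x y → Faithful R b a y x
  faithful-swap R-sym (faithful sound complete injective) =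
    faithful (R-sym ∘ sound ∘ ~-sym) (~-sym ∘ complete ∘ R-sym) (sym ∘ injective ∘ sym)

  private
    faithful-suc : ∀ {a b x y} → Faithful Consecutive a b x y → Faithful Consecutive (suc a) (suc b) x y
    faithful-suc (faithful sound complete injective) =
      faithful (shift ∘ sound) (complete ∘ unshift) (cong suc ∘ injective)
      where
      shift : ∀ {a b} → Consecutive a b → Consecutive (suc a) (suc b)
      shift (inj₁ e) = inj₁ (cong suc e)
      shift (inj₂ e) = inj₂ (cong suc e)
      unshift : ∀ {a b} → Consecutive (suc a) (suc b) → Consecutive a b
      unshift (inj₁ e) = inj₁ (ℕ.suc-injective e)
      unshift (inj₂ e) = inj₂ (ℕ.suc-injective e)

    head-faithful : ∀ {x} r {b y} → InducedPath (x ∷ r) → At (x ∷ r) b y → Faithful Consecutive 0 b x y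
    head-faithful r _ at-head =
      faithful (λ x~x → ⊥-elim (~⇒≢ x~x refl)) (λ { (inj₁ ()) ; (inj₂ ()) }) (λ _ → refl)
    head-faithful (_ ∷ _) (x~z , _ , _) (at-tail at-head) =
      faithful (λ _ → inj₁ refl) (λ _ → x~z) (⊥-elim ∘ ~⇒≢ x~z)
    head-faithful (_ ∷ _) (_ , far , _) (at-tail (at-tail p)) =
      faithful (⊥-elim ∘ All-At far p ∘ inj₂) (λ { (inj₁ ()) ; (inj₂ ()) }) (⊥-elim ∘ All-At far p ∘ inj₁)

  induced-positions : ∀ L → InducedPath L →
    ∀ {a b x y} → At L a x → At L b y → Faithful Consecutive a b x y
  induced-positions (_ ∷ r) ip at-head q = head-faithful r ip q
  induced-positions (_ ∷ r) ip p at-head = faithful-swap Consecutive-sym (head-faithful r ip p)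
  induced-positions (_ ∷ r) ip (at-tail p) (at-tail q) =
    faithful-suc (induced-positions r (induced-tail r ip) p q)

  faithful⇒induced-cycle : ∀ z R →
    (∀ {a b x y} → At (z ∷ R) a x → At (z ∷ R) b y → Faithful (CycAdj (length R)) a b x y) →
    InducedCycle H (suc (length R))
  faithful⇒induced-cycle z R positions = lookup C , injective , λ i j → mk⇔ (to i j) (from i j)
    where
    C = z ∷ R
    F : ∀ i j → Faithful (CycAdj (length R)) (toℕ i) (toℕ j) (lookup C i) (lookup C j)
    F i j = positions (At-lookup C i) (At-lookup C j)
    injective : ∀ {i j} → lookup C i ≡ lookup C j → i ≡ j
    injective {i} {j} same = Fin.toℕ-injective (Faithful.injective (F i j) same)
    to : ∀ i j → lookup C i ~ lookup C j → CycleAdj i j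
    to i j adj with Faithful.sound (F i j) adj
    ... | inj₁ i↝j = inj₁ (CSucc⇒≡cpred i↝j)
    ... | inj₂ j↝i = inj₂ (CSucc⇒≡cpred j↝i)
    from : ∀ i j → CycleAdj i j → lookup C i ~ lookup C j
    from i j (inj₁ i≡) = Faithful.complete (F i j) (inj₁ (≡cpred⇒CSucc i≡))
    from i j (inj₂ j≡) = Faithful.complete (F i j) (inj₂ (≡cpred⇒CSucc j≡))

  induced-cycle : ∀ {z w} M → InducedPath (z ∷ M) → InducedPath (M ∷ʳ w) → w ~ z →
                  InducedCycle H (suc (length (M ∷ʳ w)))
  induced-cycle {z} {w} M ipzM ipMw w~z = faithful⇒induced-cycle z (M ∷ʳ w) positions
    where
    C = z ∷ (M ∷ʳ w)
    m = length (M ∷ʳ w)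

    unwrapped : ∀ {a b x y} → ¬ (a ≡ m × b ≡ 0) → ¬ (b ≡ m × a ≡ 0) →
                Faithful Consecutive a b x y → Faithful (CycAdj m) a b x y
    unwrapped {a} {b} no-wrap no-wrap′ (faithful sound complete injective) =
      faithful (cyclic ∘ sound) (complete ∘ linear) injective
      where
      cyclic : Consecutive a b → CycAdj m a b
      cyclic (inj₁ e) = inj₁ (inj₁ e)
      cyclic (inj₂ e) = inj₂ (inj₁ e)
      linear : CycAdj m a b → Consecutive a b
      linear (inj₁ (inj₁ e))    = inj₁ e
      linear (inj₁ (inj₂ wrap)) = ⊥-elim (no-wrap wrap)
      linear (inj₂ (inj₁ e))    = inj₂ e
      linear (inj₂ (inj₂ wrap)) = ⊥-elim (no-wrap′ wrap)

    in-prefix : ∀ {a x} → At C a x → a < m → At (z ∷ M) a x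
    in-prefix p a<m = At-++⁻ˡ (z ∷ M) p (subst (_ <_) (length-∷ʳ M) a<m)

    at-last : ∀ {x} → At C m x → x ≡ w
    at-last p = At-∷ʳ-last (z ∷ M) (subst (λ i → At C i _) (length-∷ʳ M) p)

    from-last : ∀ {a b x y} → At C a x → At C b y → a ≡ m → Faithful (CycAdj m) a b x y
    from-last at-head _ 0≡m = ⊥-elim (ℕ.0≢1+n (trans 0≡m (length-∷ʳ M)))
    from-last {x = x} (at-tail p) at-head a≡m with at-last (subst (λ i → At C i x) a≡m (at-tail p))
    ... | refl = faithful (λ _ → inj₁ (inj₂ (a≡m , refl))) (λ _ → w~z) (⊥-elim ∘ ~⇒≢ w~z)
    from-last (at-tail p) (at-tail q) _ =
      unwrapped (λ { (_ , ()) }) (λ { (_ , ()) }) (faithful-suc (induced-positions (M ∷ʳ w) ipMw p q))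

    positions : ∀ {a b x y} → At C a x → At C b y → Faithful (CycAdj m) a b x y
    positions {a} {b} p q with a ℕ.<? m | b ℕ.<? m
    ... | yes a<m | yes b<m =
      unwrapped (λ (a≡m , _) → ℕ.<-irrefl a≡m a<m) (λ (b≡m , _) → ℕ.<-irrefl b≡m b<m)
                (induced-positions (z ∷ M) ipzM (in-prefix p a<m) (in-prefix q b<m))
    ... | no a≮m | _ = from-last p q (ℕ.≤-antisym (ℕ.≤-pred (At-< p)) (ℕ.≮⇒≥ a≮m))
    ... | yes _ | no b≮m =
      faithful-swap CycAdj-sym (from-last q p (ℕ.≤-antisym (ℕ.≤-pred (At-< q)) (ℕ.≮⇒≥ b≮m)))

-- Gluing induced paths into an induced cycle

-- Piece m runs from hd m up to, but excluding, hd (suc m); the last piece, suc K, closes up at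
-- hd 0. The whole cycle is hd 0 ∷ trail (suc K).
module Gluing {n : ℕ} (H : Graph n) (K : ℕ) (hd : ℕ → Fin n) (rest : ℕ → List (Fin n)) where
  open InducedPaths H

  piece : ℕ → List (Fin n)
  piece m = hd m ∷ rest m

  trail : ℕ → List (Fin n)
  trail zero    = rest 0
  trail (suc m) = trail m ++ piece (suc m)

  ∈-∷trail : ∀ m {y} → y ∈ hd 0 ∷ trail m → ∃ λ j → j ≤ m × y ∈ piece j
  ∈-∷trail m       (here y≡)       = 0 , z≤n , here y≡
  ∈-∷trail zero    (there y∈)      = 0 , z≤n , there y∈
  ∈-∷trail (suc m) (there y∈) with ∈-++⁻ (trail m) y∈
  ... | inj₂ y∈piece = suc m , ℕ.≤-refl , y∈piece
  ... | inj₁ y∈trail = let j , j≤m , y∈j = ∈-∷trail m (there y∈trail)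
                       in j , ℕ.m≤n⇒m≤1+n j≤m , y∈j

  module _ (rest≢[] : ∀ m → m ≤ suc K → rest m ≢ [])
           (link    : ∀ m → m ≤ K → InducedPath (piece m ∷ʳ hd (suc m)))
           (close   : InducedPath (piece (suc K) ∷ʳ hd 0))
           (touch   : ∀ {j j′ a b} → j < j′ → j′ ≤ suc K → a ∈ piece j → b ∈ piece j′ → Meets a b →
                      (b ≡ hd j′ × j′ ≡ suc j) ⊎ (a ≡ hd 0 × j ≡ 0 × j′ ≡ suc K)) where

    piece-induced : ∀ m → m ≤ suc K → InducedPath (piece m)
    piece-induced m m≤1+K with m ℕ.≟ suc K
    ... | yes refl = induced-++⁻ˡ (piece (suc K)) close
    ... | no  m≢   = induced-++⁻ˡ (piece m) (link m (ℕ.≤-pred (ℕ.≤∧≢⇒< m≤1+K m≢)))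

    rest-fresh : ∀ m → m ≤ suc K → ∀ {y} → y ∈ rest m → hd m ≢ y
    rest-fresh m m≤1+K = All.lookup (induced-head-fresh (rest m) (piece-induced m m≤1+K))

    rest-split : ∃₂ λ R w → rest (suc K) ≡ R ∷ʳ w
    rest-split = ≢[]⇒∷ʳ (rest (suc K)) (rest≢[] (suc K) ℕ.≤-refl)

    rest-init : List (Fin n)
    rest-init = proj₁ rest-split

    rest-last : Fin n
    rest-last = proj₁ (proj₂ rest-split)

    close-split : InducedPath ((hd (suc K) ∷ rest-init) ++ rest-last ∷ hd 0 ∷ [])
    close-split = subst InducedPath
      (trans (cong (λ r → hd (suc K) ∷ r ∷ʳ hd 0) (proj₂ (proj₂ rest-split)))
             (cong (hd (suc K) ∷_) (List.++-assoc rest-init _ _)))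
      close

    before-close : All (λ y → ¬ Meets y (hd 0)) (hd (suc K) ∷ rest-init)
    before-close = induced-far (hd (suc K) ∷ rest-init) close-split

    trail-induced : ∀ m → m ≤ K → InducedPath (hd 0 ∷ trail m ∷ʳ hd (suc m))
    trail-induced zero    _      = link 0 z≤n
    trail-induced (suc m) 1+m≤K =
      subst InducedPath (cong (hd 0 ∷_) (sym (List.++-assoc (trail m) (piece (suc m)) _)))
        (induced-join (hd 0 ∷ trail m) (trail-induced m (ℕ.<⇒≤ 1+m≤K)) (link (suc m) 1+m≤K) apart)
      where
      apart : ∀ {y v} → y ∈ hd 0 ∷ trail m → v ∈ rest (suc m) ∷ʳ hd (suc (suc m)) → ¬ Meets y v
      apart y∈ v∈ meets with ∈-∷trail m y∈ | ∈-++⁻ (rest (suc m)) v∈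
      ... | j , j≤m , y∈j | inj₁ v∈rest
            with touch (s≤s j≤m) (s≤s (ℕ.<⇒≤ 1+m≤K)) y∈j (there v∈rest) meets
      ...   | inj₁ (v≡hd , _)        = rest-fresh (suc m) (s≤s (ℕ.<⇒≤ 1+m≤K)) v∈rest (sym v≡hd)
      ...   | inj₂ (_ , _ , 1+m≡1+K) = ℕ.<-irrefl (ℕ.suc-injective 1+m≡1+K) 1+m≤K
      apart y∈ v∈ meets | j , j≤m , y∈j | inj₂ (here refl)
            with touch (s≤s (ℕ.m≤n⇒m≤1+n j≤m)) (s≤s 1+m≤K) y∈j (here refl) meets
      ...   | inj₁ (_ , 2+m≡1+j)         = ℕ.<-irrefl (sym (ℕ.suc-injective 2+m≡1+j)) (s≤s j≤m)
      ...   | inj₂ (refl , _ , 2+m≡1+K) =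
              subst (λ i → ¬ Meets (hd 0) (hd i)) (sym 2+m≡1+K) (All.head before-close ∘ Meets-sym) meets

    length-trail : ∀ m → m ≤ suc K → 2 * m < length (trail m)
    length-trail zero    _     = ≢[]⇒0<length (rest 0) (rest≢[] 0 z≤n)
    length-trail (suc m) 1+m≤ = begin-strict
      2 * suc m                                 ≡⟨ ℕ.*-suc 2 m ⟩
      2 + 2 * m                                 ≡⟨ ℕ.+-comm 2 (2 * m) ⟩
      2 * m + 2                                 <⟨ ℕ.+-monoˡ-< 2 (length-trail m (ℕ.<⇒≤ 1+m≤)) ⟩
      length (trail m) + 2                      ≤⟨ ℕ.+-monoʳ-≤ (length (trail m))
                                                     (s≤s (≢[]⇒0<length (rest (suc m)) (rest≢[] (suc m) 1+m≤))) ⟩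
      length (trail m) + length (piece (suc m)) ≡⟨ List.length-++ (trail m) ⟨
      length (trail (suc m))                    ∎
      where open ℕ.≤-Reasoning

    glued-cycle : Σ ℕ λ ℓ → 2 * (2 + K) ≤ ℓ × InducedCycle H ℓ
    glued-cycle = suc (length (M ∷ʳ rest-last)) , bound , induced-cycle M ipM ipM∷ʳ last~hd₀
      where
      L    = suc K
      M    = trail K ++ hd L ∷ rest-init
      rest≡ = proj₂ (proj₂ rest-split)

      M∷ʳ≡trail : M ∷ʳ rest-last ≡ trail L
      M∷ʳ≡trail = trans (List.++-assoc (trail K) (hd L ∷ rest-init) _)
                        (cong (λ r → trail K ++ hd L ∷ r) (sym rest≡))

      upto-last : InducedPath (hd 0 ∷ trail K ∷ʳ hd L)
      upto-last = trail-induced K ℕ.≤-refl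

      meets-last⇒hd₀ : ∀ {y v} → y ∈ hd 0 ∷ trail K → v ∈ rest L → Meets y v → y ≡ hd 0
      meets-last⇒hd₀ y∈ v∈ meets with ∈-∷trail K y∈
      ... | j , j≤K , y∈j with touch (s≤s j≤K) ℕ.≤-refl y∈j (there v∈) meets
      ...   | inj₁ (v≡hd , _) = ⊥-elim (rest-fresh L ℕ.≤-refl v∈ (sym v≡hd))
      ...   | inj₂ (y≡hd₀ , _) = y≡hd₀

      ipM∷ʳ : InducedPath (M ∷ʳ rest-last)
      ipM∷ʳ = subst InducedPath (sym M∷ʳ≡trail)
        (induced-join (trail K) (induced-tail _ upto-last) (piece-induced L ℕ.≤-refl) λ y∈ v∈ meets →
          All.lookup (induced-head-fresh _ upto-last) (∈-++⁺ˡ y∈) (sym (meets-last⇒hd₀ (there y∈) v∈ meets)))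

      ipM : InducedPath (hd 0 ∷ M)
      ipM = induced-join (hd 0 ∷ trail K) upto-last (induced-++⁻ˡ (hd L ∷ rest-init) close-split)
        λ y∈ v∈ meets →
          let y≡hd₀ = meets-last⇒hd₀ y∈ (subst (_ ∈_) (sym rest≡) (∈-++⁺ˡ v∈)) meets
          in All.lookup (All.tail before-close) v∈ (Meets-sym (subst (λ z → Meets z _) y≡hd₀ meets))

      last~hd₀ : rest-last ~ hd 0
      last~hd₀ = induced-last-adjacent (hd L ∷ rest-init) close-split

      bound : 2 * (2 + K) ≤ suc (length (M ∷ʳ rest-last))
      bound = subst (λ l → 2 * (2 + K) ≤ suc l) (cong length (sym M∷ʳ≡trail))
                (subst (_≤ suc (length (trail L))) (sym (ℕ.*-suc 2 L)) (s≤s (length-trail L ℕ.≤-refl)))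

-- Zigzags in acyclic orientations

Covers : ∀ {n} → Graph n → (Fin n → Fin n → Bool) → Set
Covers H D = ∀ a b → T (adj H a b) ⇔ (T (D a b) ⊎ T (D b a))

covers-flip : ∀ {n} {H : Graph n} {D} → Covers H D → Covers H (flip D)
covers-flip covers a b = mk⇔ (swap ∘ to) (from ∘ swap)
  where open Equivalence (covers a b)

acyclic-flip : ∀ {n} {D : Fin n → Fin n → Bool} → Acyclic D → Acyclic (flip D)
acyclic-flip acyclic a [ a⟶a ]     = acyclic a [ a⟶a ]
acyclic-flip acyclic a (b⟶a ∷ a⟶⁺b) = AcyclicWalks.no-return acyclic b⟶a (reverse id (⁺⇒⋆ a⟶⁺b))

minimal-reaching : ∀ {n} {D : Fin n → Fin n → Bool} → Acyclic D →
  ∀ {P : Fin n → Set} → (∀ v → Dec (P v)) →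
  ∀ {v₀} → P v₀ → ∃ λ v → Reach D v v₀ × P v × (∀ w → Reach D w v → P w → w ≡ v)
minimal-reaching acyclic P? Pv₀ =
  let v , v₀⟵v , Pv , minimal = AcyclicWalks.maximal-reachable (acyclic-flip acyclic) P? Pv₀
  in v , reverse id v₀⟵v , Pv , λ w w⇝v → minimal w (reverse id w⇝v)

module _ {n} {H : Graph n} {D : Fin n → Fin n → Bool} (covers : Covers H D) (acyclic : Acyclic D) where
  open Walks D
  open AcyclicWalks acyclic
  open InducedPaths H

  shortest⇒induced : ∀ {a b} (p : a ⇝ b) → (∀ (q : a ⇝ b) → steps p ≤ steps q) → InducedPath (vertices p)
  shortest⇒induced ε               _        = tt
  shortest⇒induced (a⟶b ◅ ε)       _        = Equivalence.from (covers _ _) (inj₁ a⟶b) , [] , tt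
  shortest⇒induced {a} (a⟶b ◅ b⟶c ◅ p) shortest =
    Equivalence.from (covers _ _) (inj₁ a⟶b) , All.tabulate apart ,
    shortest⇒induced (b⟶c ◅ p) (λ q → ℕ.≤-pred (shortest (a⟶b ◅ q)))
    where
    apart : ∀ {z} → z ∈ vertices p → ¬ Meets a z
    apart z∈ (inj₁ refl) = no-return a⟶b (b⟶c ◅ ⇝∈vertices p z∈)
    apart z∈ (inj₂ a~z) with Equivalence.to (covers _ _) a~z
    ... | inj₁ a⟶z = let z⇝ , z⇝≤p = ∈vertices⇝ p z∈ in
                       ℕ.<⇒≱ (s≤s (s≤s z⇝≤p)) (shortest (a⟶z ◅ z⇝))
    ... | inj₂ z⟶a = no-return a⟶b (b⟶c ◅ ⇝∈vertices p z∈ ◅◅ z⟶a ◅ ε)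

record Zigzag {n} (D : Fin n → Fin n → Bool) (k : ℕ) : Set where
  field
    u x   : Fin k → Fin n
    left  : ∀ i → Reach D (u (cpred i)) (x i)
    right : ∀ i → Reach D (u i) (x i)
    only  : ∀ j i → Reach D (u j) (x i) → j ≡ i ⊎ j ≡ cpred i

record Tight {n} {D : Fin n → Fin n → Bool} {k} (Z : Zigzag D k) : Set where
  open Zigzag Z
  field
    u-maximal : ∀ i {v} → Reach D (u (cpred i)) v → Reach D v (x (cpred i)) → Reach D v (x i) → v ≡ u (cpred i)
    x-minimal : ∀ i {w} → Reach D (u (cpred i)) w → Reach D (u i) w → Reach D w (x i) → w ≡ x i

tighten : ∀ {n} {D : Fin n → Fin n → Bool} {m} → Acyclic D → Zigzag D (suc m) → Σ (Zigzag D (suc m)) Tight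
tighten {n} {D} {m} acyclic Z =
  record { u = u′ ; x = x′ ; left = left′ ; right = proj₁ ∘ u′-common ; only = only′ } ,
  record { u-maximal = u′-maximal ; x-minimal = x′-minimal }
  where
  open Zigzag Z
  open Walks D
  open AcyclicWalks acyclic

  x-choice : ∀ i → ∃ λ w → w ⇝ x i × (u (cpred i) ⇝ w × u i ⇝ w) ×
                           (∀ w′ → w′ ⇝ w → u (cpred i) ⇝ w′ × u i ⇝ w′ → w′ ≡ w)
  x-choice i = minimal-reaching acyclic (λ w → (u (cpred i) ⇝? w) ×-dec (u i ⇝? w)) (left i , right i)

  x′ : Fin (suc m) → Fin n
  x′ = proj₁ ∘ x-choice

  x′⇝x : ∀ i → x′ i ⇝ x i
  x′⇝x = proj₁ ∘ proj₂ ∘ x-choice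

  x′-common : ∀ i → u (cpred i) ⇝ x′ i × u i ⇝ x′ i
  x′-common = proj₁ ∘ proj₂ ∘ proj₂ ∘ x-choice

  u-choice : ∀ i → ∃ λ v → u i ⇝ v × (v ⇝ x′ i × v ⇝ x′ (csucc i)) ×
                           (∀ v′ → v ⇝ v′ → v′ ⇝ x′ i × v′ ⇝ x′ (csucc i) → v′ ≡ v)
  u-choice i = maximal-reachable (λ v → (v ⇝? x′ i) ×-dec (v ⇝? x′ (csucc i)))
    (proj₂ (x′-common i) , subst (λ j → u j ⇝ x′ (csucc i)) (cpred-csucc i) (proj₁ (x′-common (csucc i))))

  u′ : Fin (suc m) → Fin n
  u′ = proj₁ ∘ u-choice

  u⇝u′ : ∀ i → u i ⇝ u′ i
  u⇝u′ = proj₁ ∘ proj₂ ∘ u-choice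

  u′-common : ∀ i → u′ i ⇝ x′ i × u′ i ⇝ x′ (csucc i)
  u′-common = proj₁ ∘ proj₂ ∘ proj₂ ∘ u-choice

  left′ : ∀ i → u′ (cpred i) ⇝ x′ i
  left′ i = subst (λ j → u′ (cpred i) ⇝ x′ j) (csucc-cpred i) (proj₂ (u′-common (cpred i)))

  only′ : ∀ j i → u′ j ⇝ x′ i → j ≡ i ⊎ j ≡ cpred i
  only′ j i u′⇝x′ = only j i (u⇝u′ j ◅◅ u′⇝x′ ◅◅ x′⇝x i)

  u′-maximal : ∀ i {v} → u′ (cpred i) ⇝ v → v ⇝ x′ (cpred i) → v ⇝ x′ i → v ≡ u′ (cpred i)
  u′-maximal i {v} u′⇝v v⇝x′ v⇝x′′ =
    proj₂ (proj₂ (proj₂ (u-choice (cpred i)))) v u′⇝v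
      (v⇝x′ , subst (λ j → v ⇝ x′ j) (sym (csucc-cpred i)) v⇝x′′)

  x′-minimal : ∀ i {w} → u′ (cpred i) ⇝ w → u′ i ⇝ w → w ⇝ x′ i → w ≡ x′ i
  x′-minimal i {w} u′⇝w u′⇝w′ w⇝x′ =
    proj₂ (proj₂ (proj₂ (x-choice i))) w w⇝x′ (u⇝u′ (cpred i) ◅◅ u′⇝w , u⇝u′ i ◅◅ u′⇝w′)

module TightCycle {n} {H : Graph n} {D : Fin n → Fin n → Bool} (covers : Covers H D) (acyclic : Acyclic D)
                  {m} (Z : Zigzag D (3 + m)) (tight : Tight Z) where
  open Zigzag Z
  open Tight tight
  open Walks D
  open AcyclicWalks acyclic
  module Rev = Walks (flip D)
  open InducedPaths H

  u↛u : ∀ i → ¬ u (cpred i) ⇝ u i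
  u↛u i u⇝u
    with only (cpred i) (csucc i) (u⇝u ◅◅ subst (λ j → u j ⇝ x (csucc i)) (cpred-csucc i) (left (csucc i)))
  ... | inj₁ e = cpred²≢ i (trans (cong cpred e) (cpred-csucc i))
  ... | inj₂ e = cpred≢ i (trans e (cpred-csucc i))

  x≢u : ∀ i → x i ≢ u i
  x≢u i x≡u = u↛u i (subst (u (cpred i) ⇝_) x≡u (left i))

  u≢x : ∀ i → u (cpred i) ≢ x i
  u≢x i u≡x with only i (cpred i) (right i ◅◅ subst (_⇝ x (cpred i)) u≡x (right (cpred i)))
  ... | inj₁ e = cpred≢ i (sym e)
  ... | inj₂ e = cpred²≢ i (sym e)

  Q : ∀ i → u (cpred i) ⇝ x i
  Q i = proj₁ (shortest-walk (left i))

  P : ∀ i → Rev._⇝_ (x i) (u i)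
  P i = proj₁ (Rev.shortest-walk (reverse id (right i)))

  Q-induced : ∀ i → InducedPath (sources (Q i) ∷ʳ x i)
  Q-induced i = subst InducedPath (vertices≡sources∷ʳ (Q i))
    (shortest⇒induced covers acyclic (Q i) (proj₂ (shortest-walk (left i))))

  P-induced : ∀ i → InducedPath (Rev.vertices (P i))
  P-induced i = shortest⇒induced (covers-flip {H = H} covers) (acyclic-flip acyclic) (P i)
    (proj₂ (Rev.shortest-walk (reverse id (right i))))

  on-Q : ∀ i {y} → y ∈ vertices (Q i) → u (cpred i) ⇝ y × y ⇝ x i
  on-Q i y∈ = ⇝∈vertices (Q i) y∈ , proj₁ (∈vertices⇝ (Q i) y∈)

  on-P : ∀ i {y} → y ∈ Rev.vertices (P i) → u i ⇝ y × y ⇝ x i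
  on-P i y∈ = reverse id (proj₁ (Rev.∈vertices⇝ (P i) y∈)) , reverse id (Rev.⇝∈vertices (P i) y∈)

  rest : Fin (3 + m) → List (Fin n)
  rest i = inner (Q i) ++ Rev.sources (P i)

  piece : Fin (3 + m) → List (Fin n)
  piece i = u (cpred i) ∷ rest i

  piece≡ : ∀ i → piece i ≡ sources (Q i) ++ Rev.sources (P i)
  piece≡ i = cong (_++ Rev.sources (P i)) (sym (sources≡∷inner (Q i) (u≢x i)))

  rest≢[] : ∀ i → rest i ≢ []
  rest≢[] i rest≡[] with List.++-conicalʳ (inner (Q i)) _ rest≡[]
  ... | sources≡[] with trans (sym (Rev.sources≡∷inner (P i) (x≢u i))) sources≡[]
  ...   | ()

  piece-induced : ∀ i → InducedPath (piece i ∷ʳ u i)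
  piece-induced i = subst InducedPath (sym piece∷ʳ≡)
    (induced-join (sources (Q i)) (Q-induced i) (P-induced i) apart)
    where
    piece∷ʳ≡ : piece i ∷ʳ u i ≡ sources (Q i) ++ Rev.vertices (P i)
    piece∷ʳ≡ = begin
      piece i ∷ʳ u i                                    ≡⟨ cong (_∷ʳ u i) (piece≡ i) ⟩
      (sources (Q i) ++ Rev.sources (P i)) ∷ʳ u i       ≡⟨ List.++-assoc (sources (Q i)) _ _ ⟩
      sources (Q i) ++ (Rev.sources (P i) ∷ʳ u i)       ≡⟨ cong (sources (Q i) ++_) (Rev.vertices≡sources∷ʳ (P i)) ⟨
      sources (Q i) ++ Rev.vertices (P i)               ∎
      where open ≡-Reasoning

    -- A shared vertex or an edge between the two paths would give a common descendant of
    -- u (cpred i) and u i strictly above x i, contradicting minimality of x i.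
    apart : ∀ {y w} → y ∈ sources (Q i) → w ∈ Rev.targets (P i) → ¬ Meets y w
    apart {y} {w} y∈ w∈ meets with on-Q i (∈sources⇒∈vertices (Q i) y∈) | on-P i (there w∈)
    ... | u⇝y , y⇝x | u⇝w , w⇝x = case meets
      where
      y≢x : y ≢ x i
      y≢x = All.lookup (induced-last-fresh (sources (Q i)) (Q-induced i)) y∈
      w≢x : w ≢ x i
      w≢x = All.lookup (induced-head-fresh (Rev.targets (P i)) (P-induced i)) w∈ ∘ sym
      case : Meets y w → ⊥
      case (inj₁ refl) = w≢x (x-minimal i u⇝y u⇝w w⇝x)
      case (inj₂ y~w) with Equivalence.to (covers y w) y~w
      ... | inj₁ y⟶w = w≢x (x-minimal i (u⇝y ◅◅ y⟶w ◅ ε) u⇝w w⇝x)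
      ... | inj₂ w⟶y = y≢x (x-minimal i u⇝y (u⇝w ◅◅ w⟶y ◅ ε) y⇝x)

  ∈piece : ∀ i {a} → a ∈ piece i → (u (cpred i) ⇝ a ⊎ u i ⇝ a) × a ⇝ x i × a ≢ u i
  ∈piece i {a} a∈ with ∈-++⁻ (sources (Q i)) (subst (a ∈_) (piece≡ i) a∈)
  ... | inj₁ a∈Q = let u⇝a , a⇝x = on-Q i (∈sources⇒∈vertices (Q i) a∈Q) in
                   inj₁ u⇝a , a⇝x , λ a≡u → u↛u i (subst (_ ⇝_) a≡u u⇝a)
  ... | inj₂ a∈P = let u⇝a , a⇝x = on-P i (Rev.∈sources⇒∈vertices (P i) a∈P) in
                   inj₂ u⇝a , a⇝x ,
                   All.lookup (induced-last-fresh (Rev.sources (P i))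
                     (subst InducedPath (Rev.vertices≡sources∷ʳ (P i)) (P-induced i))) a∈P

  piece-reach : ∀ {i i′ a b} → i ≢ i′ → a ∈ piece i → b ∈ piece i′ → a ⇝ b →
                a ≡ u (cpred i) × i′ ≡ cpred i
  piece-reach {i} {i′} {a} i≢i′ a∈ b∈ a⇝b with ∈piece i a∈ | ∈piece i′ b∈
  ... | inj₁ u⇝a , a⇝x , _ | _ , b⇝x′ , _ with only (cpred i) i′ (u⇝a ◅◅ a⇝b ◅◅ b⇝x′)
  ...   | inj₁ refl = u-maximal i u⇝a (a⇝b ◅◅ b⇝x′) a⇝x , refl
  ...   | inj₂ e    = ⊥-elim (i≢i′ (cpred-injective e))
  piece-reach {i} {i′} {a} i≢i′ a∈ b∈ a⇝b | inj₂ u⇝a , a⇝x , a≢u | _ , b⇝x′ , _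
    with only i i′ (u⇝a ◅◅ a⇝b ◅◅ b⇝x′)
  ...   | inj₁ i≡i′ = ⊥-elim (i≢i′ i≡i′)
  ...   | inj₂ refl = ⊥-elim (a≢u (u-maximal i′ u⇝a a⇝x (a⇝b ◅◅ b⇝x′)))

  piece-meets : ∀ {i i′ a b} → i ≢ i′ → a ∈ piece i → b ∈ piece i′ → Meets a b →
                (b ≡ u (cpred i′) × i ≡ cpred i′) ⊎ (a ≡ u (cpred i) × i′ ≡ cpred i)
  piece-meets i≢i′ a∈ b∈ (inj₁ refl) = inj₂ (piece-reach i≢i′ a∈ b∈ ε)
  piece-meets {a = a} {b} i≢i′ a∈ b∈ (inj₂ a~b) with Equivalence.to (covers a b) a~b
  ... | inj₁ a⟶b = inj₂ (piece-reach i≢i′ a∈ b∈ (a⟶b ◅ ε))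
  ... | inj₂ b⟶a = inj₁ (piece-reach (i≢i′ ∘ sym) b∈ a∈ (b⟶a ◅ ε))

  index : ℕ → Fin (3 + m)
  index j = j mod (3 + m)

  toℕ-index : ∀ {j} → j < 3 + m → toℕ (index j) ≡ j
  toℕ-index j< = trans (Fin.toℕ-fromℕ< _) (m<n⇒m%n≡m j<)

  CSucc⇒index : ∀ {j j′} → j < 3 + m → j′ < 3 + m → CSucc (2 + m) j j′ → index j ≡ cpred (index j′)
  CSucc⇒index j< j′< = CSucc⇒≡cpred ∘ subst₂ (CSucc (2 + m)) (sym (toℕ-index j<)) (sym (toℕ-index j′<))

  index⇒CSucc : ∀ {j j′} → j < 3 + m → j′ < 3 + m → index j ≡ cpred (index j′) → CSucc (2 + m) j j′
  index⇒CSucc j< j′< = subst₂ (CSucc (2 + m)) (toℕ-index j<) (toℕ-index j′<) ∘ ≡cpred⇒CSucc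

  link : ∀ j → j ≤ suc m → InducedPath (piece (index j) ∷ʳ u (cpred (index (suc j))))
  link j j≤ = subst (λ i → InducedPath (piece (index j) ∷ʳ u i))
    (CSucc⇒index (s≤s (ℕ.m≤n⇒m≤1+n j≤)) (s≤s (s≤s j≤)) (inj₁ refl)) (piece-induced (index j))

  close : InducedPath (piece (index (2 + m)) ∷ʳ u (cpred (index 0)))
  close = subst (λ i → InducedPath (piece (index (2 + m)) ∷ʳ u i))
    (CSucc⇒index ℕ.≤-refl (s≤s z≤n) (inj₂ (refl , refl))) (piece-induced (index (2 + m)))

  touch : ∀ {j j′ a b} → j < j′ → j′ ≤ 2 + m → a ∈ piece (index j) → b ∈ piece (index j′) → Meets a b →
          (b ≡ u (cpred (index j′)) × j′ ≡ suc j) ⊎ (a ≡ u (cpred (index 0)) × j ≡ 0 × j′ ≡ 2 + m)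
  touch {j} {j′} {a} {b} j<j′ j′≤ a∈ b∈ meets = classify (piece-meets index≢ a∈ b∈ meets)
    where
    j′< : j′ < 3 + m
    j′< = s≤s j′≤
    j< : j < 3 + m
    j< = ℕ.<-trans j<j′ j′<
    index≢ : index j ≢ index j′
    index≢ e = ℕ.<-irrefl (trans (sym (toℕ-index j<)) (trans (cong toℕ e) (toℕ-index j′<))) j<j′
    classify : (b ≡ u (cpred (index j′)) × index j ≡ cpred (index j′)) ⊎
               (a ≡ u (cpred (index j)) × index j′ ≡ cpred (index j)) →
               (b ≡ u (cpred (index j′)) × j′ ≡ suc j) ⊎
               (a ≡ u (cpred (index 0)) × j ≡ 0 × j′ ≡ 2 + m)
    classify (inj₁ (b≡ , e)) with index⇒CSucc j< j′< e
    ... | inj₁ j′≡1+j        = inj₁ (b≡ , j′≡1+j)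
    ... | inj₂ (_ , j′≡0)    = ⊥-elim (ℕ.n≮0 (subst (j <_) j′≡0 j<j′))
    classify (inj₂ (a≡ , e)) with index⇒CSucc j′< j< e
    ... | inj₁ j≡1+j′        = ⊥-elim (ℕ.<-asym j<j′ (subst (j′ <_) (sym j≡1+j′) (ℕ.n<1+n j′)))
    ... | inj₂ (j′≡2+m , j≡0) = inj₂ (subst (λ j → a ≡ u (cpred (index j))) j≡0 a≡ , j≡0 , j′≡2+m)

  induced-cycle≥6 : Σ ℕ λ ℓ → 6 ≤ ℓ × InducedCycle H ℓ
  induced-cycle≥6 =
    let ℓ , 2[3+m]≤ℓ , cycle = Gluing.glued-cycle H (suc m) (u ∘ cpred ∘ index) (rest ∘ index)
                                 (λ j _ → rest≢[] (index j)) link close touch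
    in ℓ , ℕ.≤-trans (ℕ.*-monoʳ-≤ 2 (s≤s (s≤s (s≤s z≤n)))) 2[3+m]≤ℓ , cycle

lemma2p1 : (n : ℕ) (H : Graph n) (D : Fin n → Fin n → Bool) →
    IsOrientation H D → Acyclic D →
    (k : ℕ) → 3 ≤ k →
    (u x : Fin k → Fin n) →
    Injective _≡_ _≡_ u → Injective _≡_ _≡_ x → (∀ i j → u i ≢ x j) →
    (∀ i → Reach D (u (cpred i)) (x i) × Reach D (u i) (x i)) →
    (∀ i j → j ≢ i → j ≢ cpred i → ¬ Reach D (u j) (x i)) →
    Σ ℕ λ ℓ → 6 ≤ ℓ × InducedCycle H ℓ
lemma2p1 n H D (covers , _) acyclic _ (s≤s (s≤s (s≤s {n = m} _))) u x _ _ _ reach unreach =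
  TightCycle.induced-cycle≥6 {H = H} covers acyclic (proj₁ tight) (proj₂ tight)
  where
  only : ∀ j i → Reach D (u j) (x i) → j ≡ i ⊎ j ≡ cpred i
  only j i u⇝x with j Fin.≟ i | j Fin.≟ cpred i
  ... | yes j≡i | _       = inj₁ j≡i
  ... | no _    | yes j≡  = inj₂ j≡
  ... | no j≢i  | no j≢   = ⊥-elim (unreach i j j≢i j≢ u⇝x)

  tight : Σ (Zigzag D (3 + m)) Tight
  tight = tighten acyclic record { u = u ; x = x ; left = proj₁ ∘ reach ; right = proj₂ ∘ reach ; only = only }
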